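{- Let $p\ge2$, $n\ge 6p-3$, and let $F,F'$ be facets of $\Delta_3(C_n^p)$ with $F,F'\in\mathcal{A}_i$ for the same $i\in\{1,\dots,n-2\}$. Write $F^c=\{\omega_i,i_1,i_2\}$ with $i_1<i_2$ and $F'^c=\{\omega_i,j_1,j_2\}$ with $j_1<j_2$. Suppose $i_1\in F'$, $i_1<\omega_i<j_2$, $j_2$ is not adjacent to $\omega_i$ in $C_n^p$, and $(F'\setminus\{i_1\})\cup\{j_1\}$ is not a facet of $\Delta_3(C_n^p)$. Then $\omega_i\le 2p-1$, $\omega_i<i_2<j_2$, $i_2$ is not adjacent to $\omega_i$, and $i_1$ is not adjacent to $i_2$.
   Context: $C_n^p$ is the graph on vertex set $\{0,1,\dots,n-1\}$ in which $u$ and $v$ are adjacent iff $v\equiv u\pm j \pmod n$ for some $j\in\{1,\dots,p\}$. A facet of the $3$-cut complex $\Delta_3(C_n^p)$ is a subset $F$ of the vertex set with $|F|=n-3$ such that the induced subgraph of $C_n^p$ on the complement $F^c$ is disconnected. Let $\mathbf{c}=\frac{n+1}{2}$ if $n$ is odd and $\mathbf{c}=\frac n2$ if $n$ is even. For $i\in\{1,\dots,n\}$ define $\omega_i = \mathbf{c}+(-1)^{i-1}\lfloor i/2\rfloor \pmod n$ (an enumeration $\mathbf{c},\mathbf{c}-1,\mathbf{c}+1,\mathbf{c}-2,\dots$ of all vertices). For a subset $A$ of the vertex set with $|A|=n-3$, $A\in\mathcal{A}_i$ means $\omega_i\notin A$ and $\omega_1,\dots,\omega_{i-1}\in A$. All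 inequalities between vertices are inequalities between the integers $0,\dots,n-1$. -}

module Defs where

open import Data.Nat using (ℕ; zero; suc; _+_; _∸_; _≤_; _<_; NonZero)
open import Data.Nat.DivMod using (_%_; _/_; m%n<n)
open import Data.Fin using (Fin; toℕ; fromℕ<)
open import Data.Fin.Subset using (Subset; _∈_; _∉_; _∪_; _∩_; ∁; ∣_∣; Nonempty; Empty)
open import Data.Product using (Σ; _×_; ∃)
open import Data.Sum using (_⊎_)
open import Relation.Binary.PropositionalEquality using (_≡_)
open import Relation.Nullary using (¬_)

-- Adjacency in C_n^p : v ≡ u ± j (mod n) for some j ∈ {1,…,p}.
-- "v ≡ u - j (mod n)" is written as "u ≡ v + j (mod n)".
Adj : (n p : ℕ) → .{{NonZero n}} → Fin n → Fin n → Set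
Adj n p u v = Σ ℕ λ j → (1 ≤ j) × (j ≤ p) ×
  (((toℕ u + j) % n ≡ toℕ v) ⊎ ((toℕ v + j) % n ≡ toℕ u))

Disconnected : (n p : ℕ) → .{{NonZero n}} → Subset n → Set
Disconnected n p S = Σ (Subset n) λ A → Σ (Subset n) λ B →
  (A ∪ B ≡ S) × Empty (A ∩ B) × Nonempty A × Nonempty B ×
  (∀ x y → x ∈ A → y ∈ B → ¬ Adj n p x y)

IsFacet : (n p : ℕ) → .{{NonZero n}} → Subset n → Set
IsFacet n p F = (∣ F ∣ ≡ n ∸ 3) × Disconnected n p (∁ F)

cent : ℕ → ℕ
cent n with n % 2
... | zero = n / 2
... | suc _ = (n + 1) / 2

-- ω_i = c + (-1)^(i-1) ⌊i/2⌋ (mod n), for 1 ≤ i ≤ n.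
-- For even i the subtraction is done as c + (n - ⌊i/2⌋), valid since ⌊i/2⌋ ≤ n.
ωraw : (n i : ℕ) → ℕ
ωraw n i with i % 2
... | zero = cent n + (n ∸ i / 2)
... | suc _ = cent n + i / 2

ω : (n : ℕ) → .{{NonZero n}} → ℕ → Fin n
ω n i = fromℕ< (m%n<n (ωraw n i) n)

InA : (n : ℕ) → .{{NonZero n}} → ℕ → Subset n → Set
InA n i A = (ω n i ∉ A) × (∀ k → 1 ≤ k → k < i → ω n k ∈ A)

-- Exchanging i₁ for j₁ in F' gives a set of size n − 3 with complement {ω_i, i₁, j₂}; as it is
-- not a facet, that complement is connected, and since j₂ ≁ ω_i this forces ω_i ~ i₁ ~ j₂.
-- In the disconnected complement {ω_i, i₁, i₂} of F the edge i₁ω_i then cuts i₂ off from both.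
-- The rest is distance counting on the cycle: the edge i₁j₂ cannot run the short way from i₁ up
-- to j₂ (that would make ω_i ~ j₂), so it wraps past 0, which gives i₁ < p and hence ω_i < 2p;
-- the same comparisons place i₂ strictly between ω_i and j₂.
module Submission where

open import Defs
open import Data.Nat using (ℕ; suc; _+_; _*_; _∸_; _≤_; _<_; NonZero; z≤n; s≤s; _≤?_)
open import Data.Nat.Properties
open import Data.Nat.DivMod using (_%_; m%n≤m; m<n⇒m%n≡m; [m+n]%n≡m%n)
open import Data.Fin using (Fin; toℕ)
open import Data.Fin.Properties using (toℕ<n; toℕ-injective) renaming (_≟_ to _≟ᶠ_; <⇒≢ to <⇒≢ᶠ)
open import Data.Fin.Subset using (Subset; _∈_; _∉_; _∪_; _∩_; ∁; ⁅_⁆; ∣_∣; ⊥; ⊤; inside; outside; _⊆_; Empty)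
open import Data.Fin.Subset.Properties
  using (x∈p∪q⁻; x∈p∪q⁺; x∈p∩q⁻; x∈p∩q⁺; x∈⁅x⁆; x∈⁅y⁆⇒x≡y; x∈∁p⇒x∉p; x∉p⇒x∈∁p; ⊆-antisym;
         ∣p∣≤∣x∷p∣; ∣⁅x⁆∣≡1; ∣∁p∣≡n∸∣p∣; p∪∁p≡⊤; ∩-identityʳ; ∪-identityˡ; ∪-identityʳ; ∪-assoc; ∪-idem)
open import Data.Vec using (_∷_; []; here; there)
open import Data.Product using (_×_; _,_; proj₁; proj₂)
open import Data.Sum using (_⊎_; inj₁; inj₂)
open import Function using (_∘_)
open import Relation.Binary.PropositionalEquality using (_≡_; _≢_; refl; module ≡-Reasoning; sym; trans; cong; cong₂; subst)
open import Relation.Nullary using (¬_; yes; no; contradiction)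
open import Relation.Binary using (tri<; tri≈; tri>)
open import Relation.Nullary.Decidable using (Dec; _⊎-dec_; decidable-stable)

-- For u < v < n the two arcs of the cycle between u and v have lengths v − u and u + n − v.
Near : ℕ → ℕ → ℕ → ℕ → Set
Near n p u v = v ≤ u + p ⊎ u + n ≤ v + p

near? : ∀ n p u v → Dec (Near n p u v)
near? n p u v = (v ≤? u + p) ⊎-dec (u + n ≤? v + p)

module _ {n p : ℕ} .{{_ : NonZero n}} where

  Adj-sym : {u v : Fin n} → Adj n p u v → Adj n p v u
  Adj-sym (j , 1≤j , j≤p , inj₁ e) = j , 1≤j , j≤p , inj₂ e
  Adj-sym (j , 1≤j , j≤p , inj₂ e) = j , 1≤j , j≤p , inj₁ e

  Adj⇒Near : {u v : Fin n} → toℕ u < toℕ v → Adj n p u v → Near n p (toℕ u) (toℕ v)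
  Adj⇒Near {u} {v} _ (j , _ , j≤p , inj₁ e) = inj₁ (begin
    toℕ v           ≡⟨ sym e ⟩
    (toℕ u + j) % n ≤⟨ m%n≤m (toℕ u + j) n ⟩
    toℕ u + j       ≤⟨ +-monoʳ-≤ (toℕ u) j≤p ⟩
    toℕ u + p       ∎)
    where open ≤-Reasoning
  Adj⇒Near {u} {v} u<v (j , _ , j≤p , inj₂ e) with toℕ v + j <? n
  ... | yes v+j<n = contradiction (≤-trans (m≤m+n (toℕ v) j) (≤-reflexive (trans (sym (m<n⇒m%n≡m v+j<n)) e))) (<⇒≱ u<v)
  ... | no v+j≮n = inj₂ (begin
    toℕ u + n           ≤⟨ +-monoˡ-≤ n u≤v+j∸n ⟩
    toℕ v + j ∸ n + n   ≡⟨ m∸n+n≡m n≤v+j ⟩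
    toℕ v + j           ≤⟨ +-monoʳ-≤ (toℕ v) j≤p ⟩
    toℕ v + p           ∎)
    where
    open ≤-Reasoning
    n≤v+j : n ≤ toℕ v + j
    n≤v+j = ≮⇒≥ v+j≮n
    u≤v+j∸n : toℕ u ≤ toℕ v + j ∸ n
    u≤v+j∸n = begin
      toℕ u                   ≡⟨ sym e ⟩
      (toℕ v + j) % n         ≡⟨ cong (_% n) (sym (m∸n+n≡m n≤v+j)) ⟩
      (toℕ v + j ∸ n + n) % n ≡⟨ [m+n]%n≡m%n (toℕ v + j ∸ n) n ⟩
      (toℕ v + j ∸ n) % n     ≤⟨ m%n≤m (toℕ v + j ∸ n) n ⟩
      toℕ v + j ∸ n           ∎

  Near⇒Adj : {u v : Fin n} → toℕ u < toℕ v → Near n p (toℕ u) (toℕ v) → Adj n p u v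
  Near⇒Adj {u} {v} u<v (inj₁ v≤u+p) =
    toℕ v ∸ toℕ u , m<n⇒0<n∸m u<v , m≤n+o⇒m∸n≤o (toℕ v) (toℕ u) v≤u+p ,
    inj₁ (trans (cong (_% n) (m+[n∸m]≡n (<⇒≤ u<v))) (m<n⇒m%n≡m (toℕ<n v)))
  Near⇒Adj {u} {v} _ (inj₂ u+n≤v+p) =
    toℕ u + n ∸ toℕ v , m<n⇒0<n∸m v<u+n , m≤n+o⇒m∸n≤o (toℕ u + n) (toℕ v) u+n≤v+p ,
    inj₂ (trans (cong (_% n) (m+[n∸m]≡n (<⇒≤ v<u+n)))
                (trans ([m+n]%n≡m%n (toℕ u) n) (m<n⇒m%n≡m (toℕ<n u))))
    where
    v<u+n : toℕ v < toℕ u + n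
    v<u+n = <-≤-trans (toℕ<n v) (m≤n+m n (toℕ u))

  Adj-stable : {u v : Fin n} → toℕ u < toℕ v → ¬ ¬ Adj n p u v → Adj n p u v
  Adj-stable {u} {v} u<v ¬¬adj = Near⇒Adj u<v
    (decidable-stable (near? n p (toℕ u) (toℕ v)) (λ ¬near → ¬¬adj (¬near ∘ Adj⇒Near u<v)))

-- a, b, c, d stand for i₁, ω_i, j₂, i₂.
near-configuration : ∀ {n p a b c d} → a < b → b < c → c < n → a < d → d ≢ b →
  Near n p a b → Near n p a c → ¬ Near n p b c → (d < b → ¬ Near n p d b) → ¬ Near n p a d →
  b < 2 * p × b < d × d < c
near-configuration {n} {p} {a} {b} {c} {d} a<b b<c c<n a<d d≢b ab ac ¬bc ¬db ¬ad = b<2p , b<d , d<c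
  where
  open ≤-Reasoning
  wraps : Near n p a c → a + n ≤ c + p
  wraps (inj₁ c≤a+p) = contradiction (inj₁ (≤-trans c≤a+p (+-monoˡ-≤ p (<⇒≤ a<b)))) ¬bc
  wraps (inj₂ a+n≤c+p) = a+n≤c+p
  a+n≤c+p : a + n ≤ c + p
  a+n≤c+p = wraps ac
  direct : Near n p a b → b ≤ a + p
  direct (inj₁ b≤a+p) = b≤a+p
  direct (inj₂ a+n≤b+p) = contradiction (inj₁ (≤-trans (<⇒≤ c<n) (≤-trans (m≤n+m n a) a+n≤b+p))) ¬bc
  b≤a+p : b ≤ a + p
  b≤a+p = direct ab
  a<p : a < p
  a<p = +-cancelˡ-< n a p (begin-strict
    n + a ≡⟨ +-comm n a ⟩
    a + n ≤⟨ a+n≤c+p ⟩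
    c + p <⟨ +-monoˡ-< p c<n ⟩
    n + p ∎)
  b<2p : b < 2 * p
  b<2p = begin-strict
    b     ≤⟨ b≤a+p ⟩
    a + p <⟨ +-monoˡ-< p a<p ⟩
    p + p ≡⟨ cong (p +_) (sym (+-identityʳ p)) ⟩
    2 * p ∎
  b<d : b < d
  b<d with <-cmp d b
  ... | tri< d<b _ _ = contradiction (inj₁ (≤-trans b≤a+p (+-monoˡ-≤ p (<⇒≤ a<d)))) (¬db d<b)
  ... | tri≈ _ d≡b _ = contradiction d≡b d≢b
  ... | tri> _ _ b<d = b<d
  d<c : d < c
  d<c with d <? c
  ... | yes d<c = d<c
  ... | no d≮c = contradiction (inj₂ (≤-trans a+n≤c+p (+-monoˡ-≤ p (≮⇒≥ d≮c)))) ¬ad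

∈-triple⁻ : ∀ {n} (a b c : Fin n) {x} → x ∈ ⁅ a ⁆ ∪ (⁅ b ⁆ ∪ ⁅ c ⁆) → x ≡ a ⊎ x ≡ b ⊎ x ≡ c
∈-triple⁻ a b c x∈ with x∈p∪q⁻ ⁅ a ⁆ (⁅ b ⁆ ∪ ⁅ c ⁆) x∈
... | inj₁ x∈a = inj₁ (x∈⁅y⁆⇒x≡y a x∈a)
... | inj₂ x∈bc with x∈p∪q⁻ ⁅ b ⁆ ⁅ c ⁆ x∈bc
...   | inj₁ x∈b = inj₂ (inj₁ (x∈⁅y⁆⇒x≡y b x∈b))
...   | inj₂ x∈c = inj₂ (inj₂ (x∈⁅y⁆⇒x≡y c x∈c))

∈-triple⁺ : ∀ {n} (a b c : Fin n) {x} → x ≡ a ⊎ x ≡ b ⊎ x ≡ c → x ∈ ⁅ a ⁆ ∪ (⁅ b ⁆ ∪ ⁅ c ⁆)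
∈-triple⁺ a b c (inj₁ refl)        = x∈p∪q⁺ (inj₁ (x∈⁅x⁆ a))
∈-triple⁺ a b c (inj₂ (inj₁ refl)) = x∈p∪q⁺ (inj₂ (x∈p∪q⁺ (inj₁ (x∈⁅x⁆ b))))
∈-triple⁺ a b c (inj₂ (inj₂ refl)) = x∈p∪q⁺ (inj₂ (x∈p∪q⁺ (inj₂ (x∈⁅x⁆ c))))

∈∁-exchange⁺ : ∀ {n} {q : Subset n} {x y s : Fin n} → s ∉ q ⊎ s ≡ x → s ≢ y →
  s ∈ ∁ ((q ∩ ∁ ⁅ x ⁆) ∪ ⁅ y ⁆)
∈∁-exchange⁺ {q = q} {x} {y} {s} s∉q∨s≡x s≢y = x∉p⇒x∈∁p s∉
  where
  s∉q∖x : s ∉ q ⊎ s ≡ x → s ∉ q ∩ ∁ ⁅ x ⁆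
  s∉q∖x (inj₁ s∉q) = s∉q ∘ proj₁ ∘ x∈p∩q⁻ q (∁ ⁅ x ⁆)
  s∉q∖x (inj₂ refl) s∈q∖x = x∈∁p⇒x∉p (proj₂ (x∈p∩q⁻ q (∁ ⁅ x ⁆) s∈q∖x)) (x∈⁅x⁆ x)
  s∉ : s ∉ (q ∩ ∁ ⁅ x ⁆) ∪ ⁅ y ⁆
  s∉ s∈ with x∈p∪q⁻ (q ∩ ∁ ⁅ x ⁆) ⁅ y ⁆ s∈
  ... | inj₁ s∈q∖x = s∉q∖x s∉q∨s≡x s∈q∖x
  ... | inj₂ s∈⁅y⁆ = s≢y (x∈⁅y⁆⇒x≡y y s∈⁅y⁆)

∈∁-exchange⁻ : ∀ {n} {q : Subset n} {x y s : Fin n} → s ∈ ∁ ((q ∩ ∁ ⁅ x ⁆) ∪ ⁅ y ⁆) →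
  (s ∉ q ⊎ s ≡ x) × s ≢ y
∈∁-exchange⁻ {q = q} {x} {y} {s} s∈ = s∉q∨s≡x , λ { refl → s∉ (x∈p∪q⁺ (inj₂ (x∈⁅x⁆ y))) }
  where
  s∉ : s ∉ (q ∩ ∁ ⁅ x ⁆) ∪ ⁅ y ⁆
  s∉ = x∈∁p⇒x∉p s∈
  s∉q∨s≡x : s ∉ q ⊎ s ≡ x
  s∉q∨s≡x with s ≟ᶠ x
  ... | yes s≡x = inj₂ s≡x
  ... | no s≢x = inj₁ λ s∈q → s∉ (x∈p∪q⁺ (inj₁ (x∈p∩q⁺ (s∈q , x∉p⇒x∈∁p (s≢x ∘ x∈⁅y⁆⇒x≡y x)))))

∁⊥≡⊤ : ∀ {n} → ∁ (⊥ {n}) ≡ ⊤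
∁⊥≡⊤ = trans (sym (∪-identityˡ (∁ ⊥))) (p∪∁p≡⊤ ⊥)

x∈p⇒suc∣p∩∁⁅x⁆∣≡∣p∣ : ∀ {n} {p : Subset n} {x : Fin n} → x ∈ p → suc ∣ p ∩ ∁ ⁅ x ⁆ ∣ ≡ ∣ p ∣
x∈p⇒suc∣p∩∁⁅x⁆∣≡∣p∣ {p = inside ∷ p} here =
  cong (suc ∘ ∣_∣) (trans (cong (p ∩_) ∁⊥≡⊤) (∩-identityʳ p))
x∈p⇒suc∣p∩∁⁅x⁆∣≡∣p∣ {p = inside ∷ p} (there x∈p) = cong suc (x∈p⇒suc∣p∩∁⁅x⁆∣≡∣p∣ x∈p)
x∈p⇒suc∣p∩∁⁅x⁆∣≡∣p∣ {p = outside ∷ p} (there x∈p) = x∈p⇒suc∣p∩∁⁅x⁆∣≡∣p∣ x∈p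

x∉p⇒∣p∪⁅x⁆∣≡suc∣p∣ : ∀ {n} {p : Subset n} {x : Fin n} → x ∉ p → ∣ p ∪ ⁅ x ⁆ ∣ ≡ suc ∣ p ∣
x∉p⇒∣p∪⁅x⁆∣≡suc∣p∣ {p = inside ∷ p} {Fin.zero} x∉p = contradiction here x∉p
x∉p⇒∣p∪⁅x⁆∣≡suc∣p∣ {p = outside ∷ p} {Fin.zero} _ = cong (suc ∘ ∣_∣) (∪-identityʳ p)
x∉p⇒∣p∪⁅x⁆∣≡suc∣p∣ {p = inside ∷ p} {Fin.suc x} x∉p = cong suc (x∉p⇒∣p∪⁅x⁆∣≡suc∣p∣ (x∉p ∘ there))
x∉p⇒∣p∪⁅x⁆∣≡suc∣p∣ {p = outside ∷ p} {Fin.suc x} x∉p = x∉p⇒∣p∪⁅x⁆∣≡suc∣p∣ (x∉p ∘ there)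

∣p∩∁⁅x⁆∪⁅y⁆∣≡∣p∣ : ∀ {n} {p : Subset n} {x y : Fin n} → x ∈ p → y ∉ p → ∣ (p ∩ ∁ ⁅ x ⁆) ∪ ⁅ y ⁆ ∣ ≡ ∣ p ∣
∣p∩∁⁅x⁆∪⁅y⁆∣≡∣p∣ {p = p} {x} x∈p y∉p =
  trans (x∉p⇒∣p∪⁅x⁆∣≡suc∣p∣ (y∉p ∘ proj₁ ∘ x∈p∩q⁻ p (∁ ⁅ x ⁆))) (x∈p⇒suc∣p∩∁⁅x⁆∣≡∣p∣ x∈p)

∣p∪q∣≤∣p∣+∣q∣ : ∀ {n} (p q : Subset n) → ∣ p ∪ q ∣ ≤ ∣ p ∣ + ∣ q ∣
∣p∪q∣≤∣p∣+∣q∣ [] [] = z≤n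
∣p∪q∣≤∣p∣+∣q∣ (inside ∷ p) (s ∷ q) = s≤s (≤-trans (∣p∪q∣≤∣p∣+∣q∣ p q) (+-monoʳ-≤ ∣ p ∣ (∣p∣≤∣x∷p∣ s q)))
∣p∪q∣≤∣p∣+∣q∣ (outside ∷ p) (inside ∷ q) =
  subst (suc ∣ p ∪ q ∣ ≤_) (sym (+-suc ∣ p ∣ ∣ q ∣)) (s≤s (∣p∪q∣≤∣p∣+∣q∣ p q))
∣p∪q∣≤∣p∣+∣q∣ (outside ∷ p) (outside ∷ q) = ∣p∪q∣≤∣p∣+∣q∣ p q

∣⁅x⁆∪⁅x⁆∪⁅y⁆∣≤2 : ∀ {n} (x y : Fin n) → ∣ ⁅ x ⁆ ∪ (⁅ x ⁆ ∪ ⁅ y ⁆) ∣ ≤ 2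
∣⁅x⁆∪⁅x⁆∪⁅y⁆∣≤2 x y = begin
  ∣ ⁅ x ⁆ ∪ (⁅ x ⁆ ∪ ⁅ y ⁆) ∣ ≡⟨ cong ∣_∣ (sym (∪-assoc ⁅ x ⁆ ⁅ x ⁆ ⁅ y ⁆)) ⟩
  ∣ (⁅ x ⁆ ∪ ⁅ x ⁆) ∪ ⁅ y ⁆ ∣ ≡⟨ cong (∣_∣ ∘ (_∪ ⁅ y ⁆)) (∪-idem ⁅ x ⁆) ⟩
  ∣ ⁅ x ⁆ ∪ ⁅ y ⁆ ∣           ≤⟨ ∣p∪q∣≤∣p∣+∣q∣ ⁅ x ⁆ ⁅ y ⁆ ⟩
  ∣ ⁅ x ⁆ ∣ + ∣ ⁅ y ⁆ ∣       ≡⟨ cong₂ _+_ (∣⁅x⁆∣≡1 x) (∣⁅x⁆∣≡1 y) ⟩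
  2                           ∎
  where open ≤-Reasoning

∈∁-exchange-triple⁻ : ∀ {n} {q : Subset n} {w x y z s : Fin n} → ∁ q ≡ ⁅ w ⁆ ∪ (⁅ y ⁆ ∪ ⁅ z ⁆) →
  s ∈ ∁ ((q ∩ ∁ ⁅ x ⁆) ∪ ⁅ y ⁆) → s ≡ w ⊎ s ≡ x ⊎ s ≡ z
∈∁-exchange-triple⁻ {w = w} {y = y} {z} {s} ∁q≡ s∈ with ∈∁-exchange⁻ s∈
... | inj₂ s≡x , _ = inj₂ (inj₁ s≡x)
... | inj₁ s∉q , s≢y with ∈-triple⁻ w y z (subst (s ∈_) ∁q≡ (x∉p⇒x∈∁p s∉q))
...   | inj₁ s≡w        = inj₁ s≡w
...   | inj₂ (inj₁ s≡y) = contradiction s≡y s≢y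
...   | inj₂ (inj₂ s≡z) = inj₂ (inj₂ s≡z)

module _ {n p : ℕ} .{{_ : NonZero n}} where

  star⇒¬Disconnected : {S : Subset n} {y : Fin n} → y ∈ S →
    (∀ {s} → s ∈ S → s ≡ y ⊎ Adj n p y s) → ¬ Disconnected n p S
  star⇒¬Disconnected {S} {y} y∈S star (A , B , A∪B≡S , A∩B≡∅ , (a , a∈A) , (b , b∈B) , noEdge)
    with x∈p∪q⁻ A B (subst (y ∈_) (sym A∪B≡S) y∈S)
  ... | inj₁ y∈A with star (subst (b ∈_) A∪B≡S (x∈p∪q⁺ (inj₂ b∈B)))
  ...   | inj₁ refl = A∩B≡∅ (b , x∈p∩q⁺ (y∈A , b∈B))
  ...   | inj₂ y~b = noEdge y b y∈A b∈B y~b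
  star⇒¬Disconnected {S} {y} y∈S star (A , B , A∪B≡S , A∩B≡∅ , (a , a∈A) , (b , b∈B) , noEdge)
      | inj₂ y∈B with star (subst (a ∈_) A∪B≡S (x∈p∪q⁺ (inj₁ a∈A)))
  ...   | inj₁ refl = A∩B≡∅ (a , x∈p∩q⁺ (a∈A , y∈B))
  ...   | inj₂ y~a = noEdge a y a∈A y∈B (Adj-sym y~a)

  isolated⇒Disconnected : {S : Subset n} {u v : Fin n} → u ∈ S → v ∈ S → u ≢ v →
    (∀ s → s ∈ S → s ≢ u → ¬ Adj n p u s) → Disconnected n p S
  isolated⇒Disconnected {S} {u} {v} u∈S v∈S u≢v isolated =
    ⁅ u ⁆ , S ∩ ∁ ⁅ u ⁆ , ⊆-antisym ⊆S S⊆ , disjoint ,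
    (u , x∈⁅x⁆ u) , (v , x∈p∩q⁺ (v∈S , ∈∁⁅u⁆ (u≢v ∘ sym))) , noEdge
    where
    ∈∁⁅u⁆ : ∀ {s} → s ≢ u → s ∈ ∁ ⁅ u ⁆
    ∈∁⁅u⁆ s≢u = x∉p⇒x∈∁p (s≢u ∘ x∈⁅y⁆⇒x≡y u)
    ⊆S : ⁅ u ⁆ ∪ S ∩ ∁ ⁅ u ⁆ ⊆ S
    ⊆S s∈ with x∈p∪q⁻ ⁅ u ⁆ (S ∩ ∁ ⁅ u ⁆) s∈
    ... | inj₁ s∈⁅u⁆ = subst (_∈ S) (sym (x∈⁅y⁆⇒x≡y u s∈⁅u⁆)) u∈S
    ... | inj₂ s∈S∖u = proj₁ (x∈p∩q⁻ S (∁ ⁅ u ⁆) s∈S∖u)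
    S⊆ : S ⊆ ⁅ u ⁆ ∪ S ∩ ∁ ⁅ u ⁆
    S⊆ {s} s∈S with s ≟ᶠ u
    ... | yes refl = x∈p∪q⁺ (inj₁ (x∈⁅x⁆ u))
    ... | no s≢u = x∈p∪q⁺ (inj₂ (x∈p∩q⁺ (s∈S , ∈∁⁅u⁆ s≢u)))
    disjoint : Empty (⁅ u ⁆ ∩ (S ∩ ∁ ⁅ u ⁆))
    disjoint (s , s∈) with x∈p∩q⁻ ⁅ u ⁆ (S ∩ ∁ ⁅ u ⁆) s∈
    ... | s∈⁅u⁆ , s∈S∖u = x∈∁p⇒x∉p (proj₂ (x∈p∩q⁻ S (∁ ⁅ u ⁆) s∈S∖u)) s∈⁅u⁆
    noEdge : ∀ x y → x ∈ ⁅ u ⁆ → y ∈ S ∩ ∁ ⁅ u ⁆ → ¬ Adj n p x y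
    noEdge x y x∈⁅u⁆ y∈S∖u with x∈⁅y⁆⇒x≡y u x∈⁅u⁆ | x∈p∩q⁻ S (∁ ⁅ u ⁆) y∈S∖u
    ... | refl | y∈S , y∈∁⁅u⁆ = isolated y y∈S λ { refl → x∈∁p⇒x∉p y∈∁⁅u⁆ (x∈⁅x⁆ u) }

  triple-star⇒¬Disconnected : {a b c y : Fin n} → y ∈ ⁅ a ⁆ ∪ (⁅ b ⁆ ∪ ⁅ c ⁆) →
    a ≡ y ⊎ Adj n p y a → b ≡ y ⊎ Adj n p y b → c ≡ y ⊎ Adj n p y c →
    ¬ Disconnected n p (⁅ a ⁆ ∪ (⁅ b ⁆ ∪ ⁅ c ⁆))
  triple-star⇒¬Disconnected {a} {b} {c} {y} y∈ ya yb yc = star⇒¬Disconnected y∈ linked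
    where
    linked : ∀ {s} → s ∈ ⁅ a ⁆ ∪ (⁅ b ⁆ ∪ ⁅ c ⁆) → s ≡ y ⊎ Adj n p y s
    linked s∈ with ∈-triple⁻ a b c s∈
    ... | inj₁ refl        = ya
    ... | inj₂ (inj₁ refl) = yb
    ... | inj₂ (inj₂ refl) = yc

  disconnected-triple⇒third-isolated : {w x y : Fin n} →
    Disconnected n p (⁅ w ⁆ ∪ (⁅ x ⁆ ∪ ⁅ y ⁆)) → Adj n p x w →
    y ≢ w × ¬ Adj n p y w × ¬ Adj n p x y
  disconnected-triple⇒third-isolated {w} {x} {y} disconnected x~w =
    (λ y≡w → triple-star⇒¬Disconnected w∈ (inj₁ refl) (inj₂ (Adj-sym x~w)) (inj₁ y≡w) disconnected) ,
    (λ y~w → triple-star⇒¬Disconnected w∈ (inj₁ refl) (inj₂ (Adj-sym x~w)) (inj₂ (Adj-sym y~w)) disconnected) ,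
    (λ x~y → triple-star⇒¬Disconnected x∈ (inj₂ x~w) (inj₁ refl) (inj₂ x~y) disconnected)
    where
    w∈ : w ∈ ⁅ w ⁆ ∪ (⁅ x ⁆ ∪ ⁅ y ⁆)
    w∈ = ∈-triple⁺ w x y (inj₁ refl)
    x∈ : x ∈ ⁅ w ⁆ ∪ (⁅ x ⁆ ∪ ⁅ y ⁆)
    x∈ = ∈-triple⁺ w x y (inj₂ (inj₁ refl))

  ∣∁F∣≡3 : {F : Subset n} → 3 ≤ n → IsFacet n p F → ∣ ∁ F ∣ ≡ 3
  ∣∁F∣≡3 {F} 3≤n (∣F∣≡n∸3 , _) = begin
    ∣ ∁ F ∣      ≡⟨ ∣∁p∣≡n∸∣p∣ F ⟩
    n ∸ ∣ F ∣    ≡⟨ cong (n ∸_) ∣F∣≡n∸3 ⟩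
    n ∸ (n ∸ 3) ≡⟨ m∸[m∸n]≡n 3≤n ⟩
    3           ∎
    where open ≡-Reasoning

  exchange-adjacencies : {F : Subset n} {w y z x : Fin n} → IsFacet n p F →
    ∁ F ≡ ⁅ w ⁆ ∪ (⁅ y ⁆ ∪ ⁅ z ⁆) → toℕ y < toℕ z → toℕ x < toℕ w → toℕ w < toℕ z → x ∈ F →
    ¬ Adj n p z w → ¬ IsFacet n p ((F ∩ ∁ ⁅ x ⁆) ∪ ⁅ y ⁆) →
    Adj n p x w × Adj n p x z
  exchange-adjacencies {F} {w} {y} {z} {x} facet@(∣F∣≡n∸3 , _) ∁F≡ y<z x<w w<z x∈F z≁w ¬facet =
    Adj-stable x<w (λ x≁w → ¬facet (∣G∣≡n∸3 ,
      isolated⇒Disconnected w∈∁G x∈∁G (x≢w ∘ sym) (w-isolated x≁w))) ,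
    Adj-stable (<-trans x<w w<z) (λ x≁z → ¬facet (∣G∣≡n∸3 ,
      isolated⇒Disconnected z∈∁G w∈∁G (w≢z ∘ sym) (z-isolated x≁z)))
    where
    G : Subset n
    G = (F ∩ ∁ ⁅ x ⁆) ∪ ⁅ y ⁆
    ∉F : ∀ {s} → s ≡ w ⊎ s ≡ y ⊎ s ≡ z → s ∉ F
    ∉F = x∈∁p⇒x∉p ∘ subst (_ ∈_) (sym ∁F≡) ∘ ∈-triple⁺ w y z
    x≢w : x ≢ w
    x≢w = <⇒≢ᶠ x<w
    w≢z : w ≢ z
    w≢z = <⇒≢ᶠ w<z
    x≢y : x ≢ y
    x≢y refl = ∉F (inj₂ (inj₁ refl)) x∈F
    3≤n : 3 ≤ n
    3≤n = ≤-trans (s≤s (s≤s (s≤s z≤n))) (≤-trans (s≤s (s≤s x<w)) (≤-trans (s≤s w<z) (toℕ<n z)))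
    w≢y : w ≢ y
    w≢y refl = ≤⇒≯ (subst (_≤ 2) (trans (cong ∣_∣ (sym ∁F≡)) (∣∁F∣≡3 3≤n facet)) (∣⁅x⁆∪⁅x⁆∪⁅y⁆∣≤2 w z)) (n<1+n 2)
    ∣G∣≡n∸3 : ∣ G ∣ ≡ n ∸ 3
    ∣G∣≡n∸3 = trans (∣p∩∁⁅x⁆∪⁅y⁆∣≡∣p∣ x∈F (∉F (inj₂ (inj₁ refl)))) ∣F∣≡n∸3
    w∈∁G : w ∈ ∁ G
    w∈∁G = ∈∁-exchange⁺ (inj₁ (∉F (inj₁ refl))) w≢y
    x∈∁G : x ∈ ∁ G
    x∈∁G = ∈∁-exchange⁺ (inj₂ refl) x≢y
    z∈∁G : z ∈ ∁ G
    z∈∁G = ∈∁-exchange⁺ (inj₁ (∉F (inj₂ (inj₂ refl)))) (<⇒≢ᶠ y<z ∘ sym)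
    w-isolated : ¬ Adj n p x w → ∀ s → s ∈ ∁ G → s ≢ w → ¬ Adj n p w s
    w-isolated x≁w s s∈∁G s≢w with ∈∁-exchange-triple⁻ ∁F≡ s∈∁G
    ... | inj₁ refl        = contradiction refl s≢w
    ... | inj₂ (inj₁ refl) = x≁w ∘ Adj-sym
    ... | inj₂ (inj₂ refl) = z≁w ∘ Adj-sym
    z-isolated : ¬ Adj n p x z → ∀ s → s ∈ ∁ G → s ≢ z → ¬ Adj n p z s
    z-isolated x≁z s s∈∁G s≢z with ∈∁-exchange-triple⁻ ∁F≡ s∈∁G
    ... | inj₁ refl        = z≁w
    ... | inj₂ (inj₁ refl) = x≁z ∘ Adj-sym
    ... | inj₂ (inj₂ refl) = contradiction refl s≢z

proposition3p14 : (p n : ℕ) → .{{_ : NonZero n}} → 2 ≤ p → 6 * p ∸ 3 ≤ n →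
    (i : ℕ) → 1 ≤ i → i ≤ n ∸ 2 →
    (F F' : Subset n) → IsFacet n p F → IsFacet n p F' →
    InA n i F → InA n i F' →
    (i₁ i₂ j₁ j₂ : Fin n) →
    ∁ F ≡ ⁅ ω n i ⁆ ∪ (⁅ i₁ ⁆ ∪ ⁅ i₂ ⁆) → toℕ i₁ < toℕ i₂ →
    ∁ F' ≡ ⁅ ω n i ⁆ ∪ (⁅ j₁ ⁆ ∪ ⁅ j₂ ⁆) → toℕ j₁ < toℕ j₂ →
    i₁ ∈ F' → toℕ i₁ < toℕ (ω n i) → toℕ (ω n i) < toℕ j₂ →
    ¬ Adj n p j₂ (ω n i) →
    ¬ IsFacet n p ((F' ∩ ∁ ⁅ i₁ ⁆) ∪ ⁅ j₁ ⁆) →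
    (toℕ (ω n i) ≤ 2 * p ∸ 1) × (toℕ (ω n i) < toℕ i₂) × (toℕ i₂ < toℕ j₂) ×
      ¬ Adj n p i₂ (ω n i) × ¬ Adj n p i₁ i₂
proposition3p14 p n _ _ i _ _ F F' (_ , ∁F-disconnected) F'-facet _ _ i₁ i₂ j₁ j₂
  ∁F≡ i₁<i₂ ∁F'≡ j₁<j₂ i₁∈F' i₁<w w<j₂ j₂≁w ¬facet =
  let i₁~w , i₁~j₂ = exchange-adjacencies F'-facet ∁F'≡ j₁<j₂ i₁<w w<j₂ i₁∈F' j₂≁w ¬facet
      i₂≢w , i₂≁w , i₁≁i₂ =
        disconnected-triple⇒third-isolated (subst (Disconnected n p) ∁F≡ ∁F-disconnected) i₁~w
      w<2p , w<i₂ , i₂<j₂ = near-configuration i₁<w w<j₂ (toℕ<n j₂) i₁<i₂ (i₂≢w ∘ toℕ-injective)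
        (Adj⇒Near i₁<w i₁~w) (Adj⇒Near (<-trans i₁<w w<j₂) i₁~j₂)
        (j₂≁w ∘ Adj-sym ∘ Near⇒Adj w<j₂) (λ i₂<w → i₂≁w ∘ Near⇒Adj i₂<w) (i₁≁i₂ ∘ Near⇒Adj i₁<i₂)
  in <⇒≤pred w<2p , w<i₂ , i₂<j₂ , i₂≁w , i₁≁i₂
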